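{- Let $P$ be a finite poset with a horizontal folding symmetry $\varphi$, with associated order ideal $I$ and antichain $A=I\cap\varphi(I)$, and let $\Sigma(x)=|\{I'\in J(P):x\in I'\}|$ for $x\in P$. Then (i) every $x\in I$ satisfies $\Sigma(x)\ge\frac12|J(P)|$, with equality if and only if $x\in A$; and (ii) every $y\in\varphi(I)$ satisfies $\frac12|J(P)|\ge\Sigma(y)$, with equality if and only if $y\in A$.
   Context: $J(P)$ is the set of order ideals of $P$. An antiautomorphism of $P$ is a bijection $\varphi:P\to P$ with $x<_Py$ iff $\varphi(x)>_P\varphi(y)$. A horizontal folding symmetry of $P$ is an antiautomorphism $\varphi$ with $\varphi^2=\mathrm{id}_P$ for which there exists an order ideal $I$ of $P$ such that (i) $x\le_P\varphi(x)$ for all $x\in I$, (ii) $I\cup\varphi(I)=P$, and (iii) $A:=I\cap\varphi(I)$ is an antichain of $P$. -}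

module Defs where

open import Data.Nat using (ℕ; zero; suc)
open import Data.Fin using (Fin)
open import Data.Fin.Subset using (Subset; _∈_)
open import Data.Fin.Subset.Properties using (_∈?_)
open import Data.Fin.Properties using (all?)
open import Data.Bool using (true; false)
open import Data.Vec using (_∷_; [])
open import Data.List using (List; []; _∷_; _++_; map; filter; length)
open import Data.Product using (_×_; ∃-syntax)
open import Relation.Binary.PropositionalEquality using (_≡_; _≢_)
open import Relation.Binary.Definitions using (Decidable)
open import Relation.Nullary.Decidable using (_→-dec_)
import Data.Sum
import Relation.Nullary
open import Function.Definitions using (Bijective)

_≺[_]_ : ∀ {n} → Fin n → (Fin n → Fin n → Set) → Fin n → Set
x ≺[ _≼_ ] y = (x ≼ y) × (x ≢ y)

IsOrderIdeal : ∀ {n} → (Fin n → Fin n → Set) → Subset n → Set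
IsOrderIdeal {n} _≼_ S = ∀ (x y : Fin n) → y ≼ x → x ∈ S → y ∈ S

isOrderIdeal? : ∀ {n} {_≼_ : Fin n → Fin n → Set} → Decidable _≼_ →
                (S : Subset n) → Relation.Nullary.Dec (IsOrderIdeal _≼_ S)
isOrderIdeal? _≼?_ S =
  all? (λ x → all? (λ y → (y ≼? x) →-dec ((x ∈? S) →-dec (y ∈? S))))

allSubsets : (n : ℕ) → List (Subset n)
allSubsets zero = [] ∷ []
allSubsets (suc n) = map (true ∷_) (allSubsets n) ++ map (false ∷_) (allSubsets n)

J : ∀ {n} {_≼_ : Fin n → Fin n → Set} → Decidable _≼_ → List (Subset n)
J {n} _≼?_ = filter (isOrderIdeal? _≼?_) (allSubsets n)

cardJ : ∀ {n} {_≼_ : Fin n → Fin n → Set} → Decidable _≼_ → ℕ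
cardJ _≼?_ = length (J _≼?_)

Σcount : ∀ {n} {_≼_ : Fin n → Fin n → Set} → Decidable _≼_ → Fin n → ℕ
Σcount _≼?_ x = length (filter (x ∈?_) (J _≼?_))

_∈Img[_]_ : ∀ {n} → Fin n → (Fin n → Fin n) → Subset n → Set
y ∈Img[ φ ] S = ∃[ x ] (x ∈ S × φ x ≡ y)

record IsAntiautomorphism {n} (_≼_ : Fin n → Fin n → Set) (φ : Fin n → Fin n) : Set where
  field
    bijective : Bijective _≡_ _≡_ φ
    reverses  : ∀ x y → x ≺[ _≼_ ] y → φ y ≺[ _≼_ ] φ x
    reflects  : ∀ x y → φ y ≺[ _≼_ ] φ x → x ≺[ _≼_ ] y

record IsHorizontalFoldingSymmetry {n} (_≼_ : Fin n → Fin n → Set)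
         (φ : Fin n → Fin n) (I : Subset n) : Set where
  field
    antiautomorphism : IsAntiautomorphism _≼_ φ
    involution       : ∀ x → φ (φ x) ≡ x
    orderIdeal       : IsOrderIdeal _≼_ I
    below            : ∀ x → x ∈ I → x ≼ φ x
    covers           : ∀ x → (x ∈ I) Data.Sum.⊎ (x ∈Img[ φ ] I)
    antichain        : ∀ a b → (a ∈ I × a ∈Img[ φ ] I) → (b ∈ I × b ∈Img[ φ ] I) →
                       a ≼ b → a ≡ b

-- K ↦ P ∖ φ(K) is an involution of J(P), since φ is an order-reversing involution, and
-- x ∈ P ∖ φ(K) iff φ(x) ∉ K; counting ideals therefore gives Σ(φ x) + Σ(x) = |J(P)|.
-- For x ∈ I we have x ≤ φ(x), so every ideal containing φ(x) contains x and Σ(φ x) ≤ Σ(x),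
-- strictly unless φ(x) = x, since the principal ideal ↓x separates x from φ(x).
-- The fixed points of φ are exactly the elements of A = I ∩ φ(I).
module Submission where

open import Defs
open import Data.Nat using (ℕ; zero; suc; _≤_; _<_; _+_; _*_)
open import Data.Nat.Properties
  using (+-suc; +-identityʳ; +-monoˡ-≤; +-monoʳ-≤; +-cancelˡ-≡; +-cancelʳ-≡; <⇒≢)
open import Data.Bool using (true; false)
open import Data.Bool.Properties using (T-≡)
open import Data.Fin using (Fin; _≟_)
open import Data.Fin.Subset using (Subset; _∈_; _∉_; ∁)
open import Data.Fin.Subset.Properties using (_∈?_; ⊆-antisym; x∈∁p⇒x∉p; x∉p⇒x∈∁p)
open import Data.Vec using ([]; _∷_; tabulate)
open import Data.Vec.Properties using (lookup∘tabulate; []=⇒lookup; lookup⇒[]=; ∷-injectiveʳ)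
open import Data.List using (List; []; _∷_; map; filter; length)
open import Data.List.Properties using (length-filter; filter-notAll; filter-reject; filter-≐)
open import Data.List.Membership.Propositional using (lose) renaming (_∈_ to _∈ₗ_)
open import Data.List.Membership.Propositional.Properties
  using (∈-map⁺; ∈-map⁻; ∈-++⁺ˡ; ∈-++⁺ʳ; ∈-filter⁺; ∈-filter⁻)
open import Data.List.Membership.Propositional.Properties.WithK using (unique∧set⇒bag)
open import Data.List.Relation.Binary.BagAndSetEquality using (∼bag⇒↭)
open import Data.List.Relation.Binary.Permutation.Propositional using (_↭_)
open import Data.List.Relation.Binary.Permutation.Propositional.Properties
  using (filter-↭; ↭-length)
open import Data.List.Relation.Unary.All as All using (All; []; _∷_)
open import Data.List.Relation.Unary.Any using (here)
open import Data.List.Relation.Unary.AllPairs using ([]; _∷_)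
open import Data.List.Relation.Unary.Unique.Propositional using (Unique)
import Data.List.Relation.Unary.Unique.Propositional.Properties as Unique
open import Data.Product using (_×_; _,_; proj₁; proj₂)
open import Data.Sum using (inj₁; inj₂)
open import Function using (_∘_)
open import Function.Bundles using (_⇔_; mk⇔; Equivalence)
open import Function.Properties.Equivalence using () renaming (trans to ⇔-trans)
open import Level using (Level)
open import Relation.Binary.PropositionalEquality using (_≡_; refl; sym; trans; cong; subst; subst₂; module ≡-Reasoning)
open import Relation.Binary.Structures using (IsDecPartialOrder)
open import Relation.Nullary using (¬_; yes; no; does; contradiction)
open import Relation.Nullary.Decidable using (⌊_⌋; toWitness; fromWitness; decidable-stable)
open import Relation.Unary using (Pred; Decidable; _⇒_)
open import Relation.Unary.Properties using (∁?)

open Equivalence using (to; from)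

private
  variable
    a p q : Level
    A : Set a

module _ {P : Pred A p} (P? : Decidable P) where

  length-filter-map : ∀ {b} {B : Set b} (f : B → A) (xs : List B) →
                      length (filter P? (map f xs)) ≡ length (filter (P? ∘ f) xs)
  length-filter-map f []       = refl
  length-filter-map f (x ∷ xs) with does (P? (f x))
  ... | true  = cong suc (length-filter-map f xs)
  ... | false = length-filter-map f xs

  length-filter+length-filter-∁ : (xs : List A) →
                                  length (filter P? xs) + length (filter (∁? P?) xs) ≡ length xs
  length-filter+length-filter-∁ []       = refl
  length-filter+length-filter-∁ (x ∷ xs) with does (P? x)
  ... | true  = cong suc (length-filter+length-filter-∁ xs)
  ... | false = trans (+-suc _ _) (cong suc (length-filter+length-filter-∁ xs))

module _ {P : Pred A p} {Q : Pred A q} (P? : Decidable P) (Q? : Decidable Q) where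

  filter-filter-absorb : ∀ {xs} → All (P ⇒ Q) xs → filter P? (filter Q? xs) ≡ filter P? xs
  filter-filter-absorb {[]}     []       = refl
  filter-filter-absorb {x ∷ xs} (P⇒Q ∷ hs) with Q? x
  ... | no ¬q = trans (filter-filter-absorb hs) (sym (filter-reject P? (¬q ∘ P⇒Q)))
  ... | yes _ with does (P? x)
  ...   | true  = cong (x ∷_) (filter-filter-absorb hs)
  ...   | false = filter-filter-absorb hs

  length-filter-mono : ∀ {xs} → All (P ⇒ Q) xs →
                       length (filter P? xs) ≤ length (filter Q? xs)
  length-filter-mono {xs} hs =
    subst (_≤ _) (cong length (filter-filter-absorb hs)) (length-filter P? (filter Q? xs))

  length-filter-strictMono : ∀ {xs x} → All (P ⇒ Q) xs → x ∈ₗ xs → Q x → ¬ P x →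
                             length (filter P? xs) < length (filter Q? xs)
  length-filter-strictMono {xs} hs x∈xs qx ¬px =
    subst (_< _) (cong length (filter-filter-absorb hs))
      (filter-notAll P? (filter Q? xs) (lose (∈-filter⁺ Q? x∈xs qx) ¬px))

map-involution-↭ : {f : A → A} {xs : List A} → (∀ x → f (f x) ≡ x) →
                   (∀ {x} → x ∈ₗ xs → f x ∈ₗ xs) → Unique xs → map f xs ↭ xs
map-involution-↭ {f = f} {xs} involutive closed unique =
  ∼bag⇒↭ (unique∧set⇒bag (Unique.map⁺ injective unique) unique (mk⇔ to′ from′))
  where
  injective : ∀ {x y} → f x ≡ f y → x ≡ y
  injective {x} {y} e = trans (sym (involutive x)) (trans (cong f e) (involutive y))
  to′ : ∀ {y} → y ∈ₗ map f xs → y ∈ₗ xs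
  to′ y∈ with _ , x∈xs , refl ← ∈-map⁻ f y∈ = closed x∈xs
  from′ : ∀ {y} → y ∈ₗ xs → y ∈ₗ map f xs
  from′ {y} y∈xs = subst (_∈ₗ map f xs) (involutive y) (∈-map⁺ f (closed y∈xs))

2*n≡n+n : ∀ n → 2 * n ≡ n + n
2*n≡n+n n = cong (n +_) (+-identityʳ n)

module _ {m n o : ℕ} (m+n≡o : m + n ≡ o) where

  m≤n⇒o≤2*n : m ≤ n → o ≤ 2 * n
  m≤n⇒o≤2*n m≤n = subst₂ _≤_ m+n≡o (sym (2*n≡n+n n)) (+-monoˡ-≤ n m≤n)

  m≤n⇒2*m≤o : m ≤ n → 2 * m ≤ o
  m≤n⇒2*m≤o m≤n = subst₂ _≤_ (sym (2*n≡n+n m)) m+n≡o (+-monoʳ-≤ m m≤n)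

  2*n≡o⇔m≡n : 2 * n ≡ o ⇔ m ≡ n
  2*n≡o⇔m≡n = mk⇔
    (λ e → sym (+-cancelʳ-≡ n n m (trans (sym (2*n≡n+n n)) (trans e (sym m+n≡o)))))
    (λ { refl → trans (2*n≡n+n n) m+n≡o })

  o≡2*m⇔m≡n : o ≡ 2 * m ⇔ m ≡ n
  o≡2*m⇔m≡n = mk⇔
    (λ e → sym (+-cancelˡ-≡ m n m (trans m+n≡o (trans e (2*n≡n+n m)))))
    (λ { refl → trans (sym m+n≡o) (sym (2*n≡n+n m)) })

module _ {n : ℕ} where

  toSubset : {P : Pred (Fin n) p} → Decidable P → Subset n
  toSubset P? = tabulate (λ x → ⌊ P? x ⌋)

  ∈-toSubset⇔ : {P : Pred (Fin n) p} (P? : Decidable P) {x : Fin n} → x ∈ toSubset P? ⇔ P x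
  ∈-toSubset⇔ P? {x} = mk⇔
    (λ x∈ → toWitness (from T-≡ (trans (sym (lookup∘tabulate _ x)) ([]=⇒lookup x∈))))
    (λ px → lookup⇒[]= x _ (trans (lookup∘tabulate _ x) (to T-≡ (fromWitness px))))

  preimage : (Fin n → Fin n) → Subset n → Subset n
  preimage f K = toSubset (λ x → f x ∈? K)

  -- For an involution φ the preimage is the image, so this is the complement P ∖ φ(K).
  dual : (Fin n → Fin n) → Subset n → Subset n
  dual φ K = ∁ (preimage φ K)

  ∈-dual⇔ : {φ : Fin n → Fin n} {K : Subset n} {x : Fin n} → x ∈ dual φ K ⇔ φ x ∉ K
  ∈-dual⇔ {φ} {K} = mk⇔
    (λ x∈ φx∈ → x∈∁p⇒x∉p x∈ (from (∈-toSubset⇔ (λ x → φ x ∈? K)) φx∈))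
    (λ φx∉ → x∉p⇒x∈∁p (φx∉ ∘ to (∈-toSubset⇔ (λ x → φ x ∈? K))))

  dual-involutive : {φ : Fin n → Fin n} → (∀ x → φ (φ x) ≡ x) → ∀ K → dual φ (dual φ K) ≡ K
  dual-involutive {φ} involutive K = ⊆-antisym ⊆K K⊆
    where
    ⊆K : ∀ {x} → x ∈ dual φ (dual φ K) → x ∈ K
    ⊆K {x} x∈ = subst (_∈ K) (involutive x)
      (decidable-stable (φ (φ x) ∈? K) (λ φφx∉ → to ∈-dual⇔ x∈ (from ∈-dual⇔ φφx∉)))
    K⊆ : ∀ {x} → x ∈ K → x ∈ dual φ (dual φ K)
    K⊆ {x} x∈ = from ∈-dual⇔ (λ φx∈ → to ∈-dual⇔ φx∈ (subst (_∈ K) (sym (involutive x)) x∈))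

allSubsets-complete : ∀ n (K : Subset n) → K ∈ₗ allSubsets n
allSubsets-complete zero    []          = here refl
allSubsets-complete (suc n) (true  ∷ K) = ∈-++⁺ˡ (∈-map⁺ (true ∷_) (allSubsets-complete n K))
allSubsets-complete (suc n) (false ∷ K) =
  ∈-++⁺ʳ (map (true ∷_) (allSubsets n)) (∈-map⁺ (false ∷_) (allSubsets-complete n K))

allSubsets-unique : ∀ n → Unique (allSubsets n)
allSubsets-unique zero    = [] ∷ []
allSubsets-unique (suc n) =
  Unique.++⁺ (Unique.map⁺ ∷-injectiveʳ (allSubsets-unique n))
             (Unique.map⁺ ∷-injectiveʳ (allSubsets-unique n)) disjoint
  where
  disjoint : ∀ {K} → ¬ (K ∈ₗ map (true ∷_) (allSubsets n) × K ∈ₗ map (false ∷_) (allSubsets n))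
  disjoint (K∈ , K∈′) with _ , _ , refl ← ∈-map⁻ (true ∷_) K∈ | _ , _ , () ← ∈-map⁻ (false ∷_) K∈′

module OrderIdeals {n : ℕ} {_≼_ : Fin n → Fin n → Set} (po : IsDecPartialOrder _≡_ _≼_) where
  open IsDecPartialOrder po using (_≤?_; antisym) renaming (refl to ≼-refl; trans to ≼-trans)

  Σ : Fin n → ℕ
  Σ = Σcount _≤?_

  ∈J⇔isOrderIdeal : ∀ {K} → K ∈ₗ J _≤?_ ⇔ IsOrderIdeal _≼_ K
  ∈J⇔isOrderIdeal {K} = mk⇔
    (λ K∈J → proj₂ (∈-filter⁻ (isOrderIdeal? _≤?_) {xs = allSubsets n} K∈J))
    (∈-filter⁺ (isOrderIdeal? _≤?_) (allSubsets-complete n K))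

  J-unique : Unique (J _≤?_)
  J-unique = Unique.filter⁺ (isOrderIdeal? _≤?_) (allSubsets-unique n)

  ↓_ : Fin n → Subset n
  ↓ x = toSubset (_≤? x)

  ↓-isOrderIdeal : ∀ x → IsOrderIdeal _≼_ (↓ x)
  ↓-isOrderIdeal x y z z≼y y∈↓x =
    from (∈-toSubset⇔ (_≤? x)) (≼-trans z≼y (to (∈-toSubset⇔ (_≤? x)) y∈↓x))

  J-downClosed : ∀ {x y} → x ≼ y → All (λ K → y ∈ K → x ∈ K) (J _≤?_)
  J-downClosed {x} {y} x≼y = All.tabulate (λ K∈J → to ∈J⇔isOrderIdeal K∈J y x x≼y)

  Σ-antitone : ∀ {x y} → x ≼ y → Σ y ≤ Σ x
  Σ-antitone {x} {y} x≼y = length-filter-mono (y ∈?_) (x ∈?_) (J-downClosed x≼y)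

  Σ-strictlyAntitone : ∀ {x y} → x ≺[ _≼_ ] y → Σ y < Σ x
  Σ-strictlyAntitone {x} {y} (x≼y , x≢y) =
    length-filter-strictMono (y ∈?_) (x ∈?_) (J-downClosed x≼y)
      (from ∈J⇔isOrderIdeal (↓-isOrderIdeal x))
      (from (∈-toSubset⇔ (_≤? x)) ≼-refl)
      (λ y∈↓x → x≢y (antisym x≼y (to (∈-toSubset⇔ (_≤? x)) y∈↓x)))

  module Duality {φ : Fin n → Fin n} (involutive : ∀ x → φ (φ x) ≡ x)
                 (reverses : ∀ {x y} → x ≼ y → φ y ≼ φ x) where

    dual-isOrderIdeal : ∀ {K} → IsOrderIdeal _≼_ K → IsOrderIdeal _≼_ (dual φ K)
    dual-isOrderIdeal K-ideal x y y≼x x∈ =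
      from ∈-dual⇔ (λ φy∈K → to ∈-dual⇔ x∈ (K-ideal (φ y) (φ x) (reverses y≼x) φy∈K))

    map-dual-J↭J : map (dual φ) (J _≤?_) ↭ J _≤?_
    map-dual-J↭J = map-involution-↭ (dual-involutive involutive)
      (from ∈J⇔isOrderIdeal ∘ dual-isOrderIdeal ∘ to ∈J⇔isOrderIdeal) J-unique

    Σ∘φ+Σ≡cardJ : ∀ x → Σ (φ x) + Σ x ≡ cardJ _≤?_
    Σ∘φ+Σ≡cardJ x = begin
      Σ (φ x) + Σ x
        ≡⟨ cong (Σ (φ x) +_) (sym (↭-length (filter-↭ (x ∈?_) map-dual-J↭J))) ⟩
      Σ (φ x) + length (filter (x ∈?_) (map (dual φ) (J _≤?_)))
        ≡⟨ cong (Σ (φ x) +_) (length-filter-map (x ∈?_) (dual φ) (J _≤?_)) ⟩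
      Σ (φ x) + length (filter (λ K → x ∈? dual φ K) (J _≤?_))
        ≡⟨ cong (λ xs → Σ (φ x) + length xs)
             (filter-≐ _ (∁? (φ x ∈?_)) (to ∈-dual⇔ , from ∈-dual⇔) (J _≤?_)) ⟩
      Σ (φ x) + length (filter (∁? (φ x ∈?_)) (J _≤?_))
        ≡⟨ length-filter+length-filter-∁ (φ x ∈?_) (J _≤?_) ⟩
      cardJ _≤?_ ∎
      where open ≡-Reasoning

    Σ∘φ≡Σ⇔fixed : ∀ {x} → x ≼ φ x → Σ (φ x) ≡ Σ x ⇔ φ x ≡ x
    Σ∘φ≡Σ⇔fixed {x} x≼φx = mk⇔ fixed (cong Σ)
      where
      fixed : Σ (φ x) ≡ Σ x → φ x ≡ x
      fixed balanced with φ x ≟ x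
      ... | yes φx≡x = φx≡x
      ... | no  φx≢x = contradiction balanced
                         (<⇒≢ (Σ-strictlyAntitone (x≼φx , φx≢x ∘ sym)))

module FoldingSymmetry {n : ℕ} {_≼_ : Fin n → Fin n → Set} (po : IsDecPartialOrder _≡_ _≼_)
  {φ : Fin n → Fin n} {I : Subset n} (H : IsHorizontalFoldingSymmetry _≼_ φ I) where
  open IsDecPartialOrder po using (antisym) renaming (refl to ≼-refl)
  open IsHorizontalFoldingSymmetry H
  open OrderIdeals po public

  reverses≼ : ∀ {x y} → x ≼ y → φ y ≼ φ x
  reverses≼ {x} {y} x≼y with x ≟ y
  ... | yes refl = ≼-refl
  ... | no  x≢y  = proj₁ (IsAntiautomorphism.reverses antiautomorphism x y (x≼y , x≢y))

  open Duality involution reverses≼ public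

  fixed⇔∈A : ∀ {x} → φ x ≡ x ⇔ (x ∈ I × x ∈Img[ φ ] I)
  fixed⇔∈A {x} = mk⇔ fixed⇒∈A ∈A⇒fixed
    where
    fixed⇒∈A : φ x ≡ x → x ∈ I × x ∈Img[ φ ] I
    fixed⇒∈A φx≡x with covers x
    ... | inj₁ x∈I = x∈I , (x , x∈I , φx≡x)
    ... | inj₂ (w , w∈I , refl) =
      subst (_∈ I) (trans (sym (involution w)) φx≡x) w∈I , (w , w∈I , refl)
    ∈A⇒fixed : x ∈ I × x ∈Img[ φ ] I → φ x ≡ x
    ∈A⇒fixed (x∈I , (w , w∈I , refl)) =
      antisym (subst (_≼ φ w) (sym (involution w)) (below w w∈I)) (below (φ w) x∈I)

  fixed⇔φ-fixed : ∀ {x} → φ x ≡ x ⇔ φ (φ x) ≡ φ x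
  fixed⇔φ-fixed {x} = mk⇔ (cong φ) (λ e → trans (sym e) (involution x))

corollary3p4 : (n : ℕ) (_≼_ : Fin n → Fin n → Set) (po : IsDecPartialOrder _≡_ _≼_)
    (φ : Fin n → Fin n) (I : Subset n) → IsHorizontalFoldingSymmetry _≼_ φ I →
    ((x : Fin n) → x ∈ I →
      (cardJ (IsDecPartialOrder._≤?_ po) ≤ 2 * Σcount (IsDecPartialOrder._≤?_ po) x)
      × ((2 * Σcount (IsDecPartialOrder._≤?_ po) x ≡ cardJ (IsDecPartialOrder._≤?_ po))
         ⇔ (x ∈ I × x ∈Img[ φ ] I)))
    × ((y : Fin n) → y ∈Img[ φ ] I →
      (2 * Σcount (IsDecPartialOrder._≤?_ po) y ≤ cardJ (IsDecPartialOrder._≤?_ po))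
      × ((cardJ (IsDecPartialOrder._≤?_ po) ≡ 2 * Σcount (IsDecPartialOrder._≤?_ po) y)
         ⇔ (y ∈ I × y ∈Img[ φ ] I)))
corollary3p4 n _≼_ po φ I H = onI , onφI
  where
  open IsDecPartialOrder po using (_≤?_)
  open IsHorizontalFoldingSymmetry H using (below)
  open FoldingSymmetry po H

  onI : (x : Fin n) → x ∈ I →
        (cardJ _≤?_ ≤ 2 * Σ x) × ((2 * Σ x ≡ cardJ _≤?_) ⇔ (x ∈ I × x ∈Img[ φ ] I))
  onI x x∈I =
    m≤n⇒o≤2*n (Σ∘φ+Σ≡cardJ x) (Σ-antitone (below x x∈I)) ,
    ⇔-trans (2*n≡o⇔m≡n (Σ∘φ+Σ≡cardJ x))
      (⇔-trans (Σ∘φ≡Σ⇔fixed (below x x∈I)) fixed⇔∈A)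

  onφI : (y : Fin n) → y ∈Img[ φ ] I →
         (2 * Σ y ≤ cardJ _≤?_) × ((cardJ _≤?_ ≡ 2 * Σ y) ⇔ (y ∈ I × y ∈Img[ φ ] I))
  onφI _ (x , x∈I , refl) =
    m≤n⇒2*m≤o (Σ∘φ+Σ≡cardJ x) (Σ-antitone (below x x∈I)) ,
    ⇔-trans (o≡2*m⇔m≡n (Σ∘φ+Σ≡cardJ x))
      (⇔-trans (Σ∘φ≡Σ⇔fixed (below x x∈I)) (⇔-trans fixed⇔φ-fixed fixed⇔∈A))
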